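{- Let $r\ge2$ be an integer that is the order of some finite projective plane, and let $s\ge r+1$ be an integer. Then (1) there exists a colour set $C$ with $|C|=(r^2+r+1)s$ such that $\mathcal M^*(r^2+r+1,(r+1)s,C)\neq\emptyset$; and (2) $\operatorname{achr}(K_{r^2+r+1}\square K_{(r+1)s})\ge (r^2+r+1)s$.
   Context: A vertex colouring $f:V(G)\to C$ of a finite simple graph $G$ is complete if for any two distinct $c_1,c_2\in C$ there are adjacent vertices $v_1,v_2$ with $f(v_1)=c_1$, $f(v_2)=c_2$. The achromatic number $\operatorname{achr}(G)$ is the maximum number of colours in a proper complete vertex colouring of $G$. The Cartesian product $G_1\square G_2$ has vertex set $V(G_1)\times V(G_2)$, with $(x_1,y_1)$ adjacent to $(x_2,y_2)$ iff either $x_1=x_2$ and $y_1y_2\in E(G_2)$, or $x_1x_2\in E(G_1)$ and $y_1=y_2$. For a finite set $C$, $\mathcal M(p,q,C)$ is the set of $p\times q$ matrices with entries in $C$ whose rows each consist of $q$ pairwise distinct elements, whose columns each consist of $p$ pairwise distinct elements, and such that every pair of distinct elements of $C$ occurs together in some row or column; $\mathcal M^*(p,q,C)$ is the subset of those matrices in which every pair of distinct elements of $C$ occurs together in some row. For $r\ge2$, a finite projective plane of order $r$ is a pair $(P,\mathcal L)$ of a finite set $P$ of points and a set $\mathcal L$ of subsets of $P$ (lines) such that any two distinct points lie in exactly one common line, any two distinct lines intersect, there are four points no three of which lie on a common line, and some line has exactly $r+1$ points; $r$ is a finite projective plane order if such a plane exists. -}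

module Defs where

open import Level using (Level; 0ℓ)
open import Data.Nat using (ℕ; suc; _+_; _*_; _≤_)
open import Data.Fin using (Fin)
open import Data.Fin.Subset using (Subset; _∈_; ∣_∣)
open import Data.Product using (Σ; ∃; ∃-syntax; _×_; _,_)
open import Data.Sum using (_⊎_)
open import Relation.Nullary using (¬_)
open import Relation.Binary.PropositionalEquality using (_≡_; _≢_)
open import Function.Definitions using (Injective)

-- Finite projective planes
-- Points are Fin n, lines are indexed by Fin m, line l is the subset L l.
-- L is injective, so the lines form a *set* of subsets.

record IsProjectivePlane (r : ℕ) {n m : ℕ} (L : Fin m → Subset n) : Set where
  field
    lines-distinct : Injective _≡_ _≡_ L
    two-points : ∀ (x y : Fin n) → x ≢ y →
      ∃[ l ] ((x ∈ L l × y ∈ L l) ×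
              (∀ l′ → x ∈ L l′ → y ∈ L l′ → l′ ≡ l))
    two-lines : ∀ (l l′ : Fin m) → l ≢ l′ → ∃[ x ] (x ∈ L l × x ∈ L l′)
    four-points : ∃[ q ] (Injective _≡_ _≡_ q ×
      (∀ (i j k : Fin 4) → i ≢ j → j ≢ k → i ≢ k →
        ¬ (∃[ l ] (q i ∈ L l × q j ∈ L l × q k ∈ L l))))
    line-size : ∃[ l ] (∣ L l ∣ ≡ suc r)

IsProjectivePlaneOrder : ℕ → Set
IsProjectivePlaneOrder r =
  ∃[ n ] ∃[ m ] Σ (Fin m → Subset n) (IsProjectivePlane r)

Matrix : ℕ → ℕ → Set → Set
Matrix p q C = Fin p → Fin q → C

RowsDistinct : ∀ {p q} {C : Set} → Matrix p q C → Set
RowsDistinct M = ∀ i → Injective _≡_ _≡_ (M i)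

ColsDistinct : ∀ {p q} {C : Set} → Matrix p q C → Set
ColsDistinct M = ∀ j → Injective _≡_ _≡_ (λ i → M i j)

PairInSomeRow : ∀ {p q} {C : Set} → Matrix p q C → C → C → Set
PairInSomeRow M c₁ c₂ = ∃[ i ] ∃[ j ] ∃[ j′ ] (M i j ≡ c₁ × M i j′ ≡ c₂)

PairInSomeCol : ∀ {p q} {C : Set} → Matrix p q C → C → C → Set
PairInSomeCol M c₁ c₂ = ∃[ j ] ∃[ i ] ∃[ i′ ] (M i j ≡ c₁ × M i′ j ≡ c₂)

InM : ∀ {p q} {C : Set} → Matrix p q C → Set
InM {C = C} M = RowsDistinct M × ColsDistinct M ×
  (∀ (c₁ c₂ : C) → c₁ ≢ c₂ → PairInSomeRow M c₁ c₂ ⊎ PairInSomeCol M c₁ c₂)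

InM* : ∀ {p q} {C : Set} → Matrix p q C → Set
InM* {C = C} M = InM M ×
  (∀ (c₁ c₂ : C) → c₁ ≢ c₂ → PairInSomeRow M c₁ c₂)

M*-nonempty : ℕ → ℕ → Set → Set
M*-nonempty p q C = Σ (Matrix p q C) InM*

record Graph : Set₁ where
  field
    V   : Set
    Adj : V → V → Set
open Graph public

K : ℕ → Graph
K n = record { V = Fin n ; Adj = λ x y → x ≢ y }

_□_ : Graph → Graph → Graph
G₁ □ G₂ = record
  { V   = V G₁ × V G₂
  ; Adj = λ { (x₁ , y₁) (x₂ , y₂) →
        (x₁ ≡ x₂ × Adj G₂ y₁ y₂) ⊎ (Adj G₁ x₁ x₂ × y₁ ≡ y₂) } }

IsProper : (G : Graph) {C : Set} → (V G → C) → Set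
IsProper G f = ∀ u v → Adj G u v → f u ≢ f v

IsComplete : (G : Graph) {C : Set} → (V G → C) → Set
IsComplete G {C} f = ∀ (c₁ c₂ : C) → c₁ ≢ c₂ →
  ∃[ u ] ∃[ v ] (Adj G u v × f u ≡ c₁ × f v ≡ c₂)

-- achr(G) ≥ k : some proper complete colouring uses k′ ≥ k colours
-- (the maximum over such k′ is ≥ k iff such a k′ exists)
AchrAtLeast : Graph → ℕ → Set
AchrAtLeast G k = ∃[ k′ ] (k ≤ k′ ×
  ∃[ f ] (IsProper G {Fin k′} f × IsComplete G f))

-- The rows of the matrix are the p = r² + r + 1 lines of the plane, its colours are the pairs
-- (point x, residue k mod s), and its columns are the pairs (a, b) with a < r + 1 and b < s.
-- The entry in row l and column (a, b) is (x, b + t mod s), where x is the a-th point of l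
-- and t < r + 1 ≤ s is the position of l among the r + 1 lines through x.  A row is then
-- injective; two equal entries in one column have the same point and the same t, hence the
-- same line; and the colours (x, k) and (x′, k′) both occur in the row of a line through x
-- and x′.  Read as a colouring of K_p □ K_q, every matrix in M(p, q, C) is proper and complete.
-- The counting behind it: all lines have r + 1 points (perspectivity from a point off two
-- lines), all points lie on r + 1 lines, and so there are 1 + (r + 1) r points and lines.

module Submission where

open import Defs
open import Data.Empty using (⊥; ⊥-elim)
open import Data.Fin using (Fin; zero; suc; toℕ; inject≤; punchIn; punchOut)
open import Data.Fin.Patterns using (0F; 1F; 2F; 3F)
open import Data.Fin.Properties
  using (_≟_; toℕ-fromℕ<; toℕ<n; toℕ-injective; inject≤-injective; punchInᵢ≢i; punchOut-cong;
         punchIn-punchOut; punchOut-punchIn; 1↔⊤; +↔⊎; *↔×)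
open import Data.Fin.Subset using (Subset; _∈_; _∉_; ∣_∣; inside; outside)
open import Data.Fin.Subset.Properties using (_∈?_)
open import Data.Nat using (ℕ; zero; suc; _+_; _*_; _∸_; _<_; _≤_; NonZero)
open import Data.Nat.DivMod using (_%_; _mod_; %-distribˡ-+; m%n%n≡m%n; [m+n]%n≡m%n; m<n⇒m%n≡m)
open import Data.Nat.Properties using (≤-refl; <⇒≤; +-assoc; +-comm; m+[n∸m]≡n; m∸n+n≡m)
open import Data.Product using (Σ; ∃-syntax; _×_; _,_; proj₁; proj₂; uncurry)
open import Data.Product.Function.NonDependent.Propositional using (_×-↔_)
open import Data.Sum using (_⊎_; inj₁; inj₂)
open import Data.Sum.Function.Propositional using (_⊎-↔_)
open import Data.Unit using (⊤; tt)
open import Data.Vec using ([]; _∷_; here; there)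
open import Data.Vec.Properties.WithK using ([]=-irrelevant)
open import Function using (_∘_; _$_)
open import Function.Bundles using (_↔_; Inverse; Injection; mk↔ₛ′)
open import Function.Definitions using (Injective)
open import Function.Properties.Inverse using (↔-sym; ↔-trans; ↔-refl; ↔⇒↣)
open import Relation.Binary.Definitions using (DecidableEquality)
open import Relation.Binary.PropositionalEquality
open import Relation.Nullary using (Irrelevant; yes; no)

open Inverse using (to; from; strictlyInverseˡ; strictlyInverseʳ)

to-injective : ∀ {A B : Set} (e : A ↔ B) → Injective _≡_ _≡_ (to e)
to-injective e = Injection.injective (↔⇒↣ e)

from-injective : ∀ {A B : Set} (e : A ↔ B) → Injective _≡_ _≡_ (from e)
from-injective e = to-injective (↔-sym e)

module _ {A : Set} {P : A → Set} (P-irrelevant : ∀ {x} → Irrelevant (P x)) where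

  Σ-≡-proj₁ : {u v : Σ A P} → proj₁ u ≡ proj₁ v → u ≡ v
  Σ-≡-proj₁ {x , p} {.x , q} refl = cong (x ,_) (P-irrelevant p q)

∈-irrelevant : ∀ {n} {x : Fin n} {p : Subset n} → Irrelevant (x ∈ p)
∈-irrelevant = []=-irrelevant

∈↔Fin∣∣ : ∀ {n} (p : Subset n) → Σ (Fin n) (_∈ p) ↔ Fin ∣ p ∣
∈↔Fin∣∣ [] = mk↔ₛ′ (λ ()) (λ ()) (λ ()) (λ ())
∈↔Fin∣∣ (outside ∷ p) = mk↔ₛ′ to′ from′ (strictlyInverseˡ e) from∘to
  where
  e = ∈↔Fin∣∣ p
  to′ : Σ (Fin _) (_∈ outside ∷ p) → Fin ∣ p ∣
  to′ (suc x , there h) = to e (x , h)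
  from′ : Fin ∣ p ∣ → Σ (Fin _) (_∈ outside ∷ p)
  from′ j = suc (proj₁ (from e j)) , there (proj₂ (from e j))
  from∘to : ∀ u → from′ (to′ u) ≡ u
  from∘to (suc x , there h) = cong (λ u → suc (proj₁ u) , there (proj₂ u)) (strictlyInverseʳ e (x , h))
∈↔Fin∣∣ (inside ∷ p) = mk↔ₛ′ to′ from′ to∘from from∘to
  where
  e = ∈↔Fin∣∣ p
  to′ : Σ (Fin _) (_∈ inside ∷ p) → Fin (suc ∣ p ∣)
  to′ (zero , here) = zero
  to′ (suc x , there h) = suc (to e (x , h))
  from′ : Fin (suc ∣ p ∣) → Σ (Fin _) (_∈ inside ∷ p)
  from′ zero = zero , here
  from′ (suc j) = suc (proj₁ (from e j)) , there (proj₂ (from e j))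
  to∘from : ∀ j → to′ (from′ j) ≡ j
  to∘from zero = refl
  to∘from (suc j) = cong suc (strictlyInverseˡ e j)
  from∘to : ∀ u → from′ (to′ u) ≡ u
  from∘to (zero , here) = refl
  from∘to (suc x , there h) = cong (λ u → suc (proj₁ u) , there (proj₂ u)) (strictlyInverseʳ e (x , h))

module CyclicGroup (d : ℕ) .{{_ : NonZero d}} where

  _+ₘ_ : Fin d → Fin d → Fin d
  i +ₘ j = (toℕ i + toℕ j) mod d

  _-ₘ_ : Fin d → Fin d → Fin d
  i -ₘ j = (toℕ i + (d ∸ toℕ j)) mod d

  private
    toℕ-mod : ∀ a → toℕ (a mod d) ≡ a % d
    toℕ-mod a = toℕ-fromℕ< _

    [[a+x]%d+y]%d≡a : ∀ {a} x y → a < d → x + y ≡ d → ((a + x) % d + y) % d ≡ a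
    [[a+x]%d+y]%d≡a {a} x y a<d x+y≡d = begin
      ((a + x) % d + y) % d          ≡⟨ %-distribˡ-+ ((a + x) % d) y d ⟩
      ((a + x) % d % d + y % d) % d  ≡⟨ cong (λ w → (w + y % d) % d) (m%n%n≡m%n (a + x) d) ⟩
      ((a + x) % d + y % d) % d      ≡⟨ %-distribˡ-+ (a + x) y d ⟨
      (a + x + y) % d                ≡⟨ cong (_% d) (trans (+-assoc a x y) (cong (a +_) x+y≡d)) ⟩
      (a + d) % d                    ≡⟨ [m+n]%n≡m%n a d ⟩
      a % d                          ≡⟨ m<n⇒m%n≡m a<d ⟩
      a                              ∎
      where open ≡-Reasoning

  +ₘ-comm : ∀ i j → i +ₘ j ≡ j +ₘ i
  +ₘ-comm i j = cong (_mod d) (+-comm (toℕ i) (toℕ j))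

  i+ₘj-ₘj≡i : ∀ i j → (i +ₘ j) -ₘ j ≡ i
  i+ₘj-ₘj≡i i j = toℕ-injective (begin
    toℕ ((i +ₘ j) -ₘ j)                             ≡⟨ toℕ-mod _ ⟩
    (toℕ (i +ₘ j) + (d ∸ toℕ j)) % d                ≡⟨ cong (λ w → (w + (d ∸ toℕ j)) % d) (toℕ-mod _) ⟩
    ((toℕ i + toℕ j) % d + (d ∸ toℕ j)) % d         ≡⟨ [[a+x]%d+y]%d≡a (toℕ j) (d ∸ toℕ j) (toℕ<n i)
                                                         (m+[n∸m]≡n (<⇒≤ (toℕ<n j))) ⟩
    toℕ i                                           ∎)
    where open ≡-Reasoning

  i-ₘj+ₘj≡i : ∀ i j → (i -ₘ j) +ₘ j ≡ i
  i-ₘj+ₘj≡i i j = toℕ-injective (begin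
    toℕ ((i -ₘ j) +ₘ j)                             ≡⟨ toℕ-mod _ ⟩
    (toℕ (i -ₘ j) + toℕ j) % d                      ≡⟨ cong (λ w → (w + toℕ j) % d) (toℕ-mod _) ⟩
    ((toℕ i + (d ∸ toℕ j)) % d + toℕ j) % d         ≡⟨ [[a+x]%d+y]%d≡a (d ∸ toℕ j) (toℕ j) (toℕ<n i)
                                                         (m∸n+n≡m (<⇒≤ (toℕ<n j))) ⟩
    toℕ i                                           ∎)
    where open ≡-Reasoning

  +ₘ-cancelʳ : ∀ {i i′} j → i +ₘ j ≡ i′ +ₘ j → i ≡ i′
  +ₘ-cancelʳ {i} {i′} j eq = trans (sym (i+ₘj-ₘj≡i i j)) (trans (cong (_-ₘ j) eq) (i+ₘj-ₘj≡i i′ j))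

  +ₘ-cancelˡ : ∀ i {j j′} → i +ₘ j ≡ i +ₘ j′ → j ≡ j′
  +ₘ-cancelˡ i {j} {j′} eq = +ₘ-cancelʳ i (trans (+ₘ-comm j i) (trans eq (+ₘ-comm i j′)))

-- Every x ≢ x₀ lies on exactly one block through x₀, so X consists of x₀ together with,
-- for each block through x₀, its k members other than x₀.
module PencilDecomposition
  {X Y : Set} (I : X → Y → Set) (I-irrelevant : ∀ {x y} → Irrelevant (I x y))
  (_≟_ : DecidableEquality X) {k : ℕ}
  (block : ∀ y → Σ X (λ x → I x y) ↔ Fin (suc k))
  (x₀ : X)
  (join : ∀ x → x ≢ x₀ → ∃[ y ] ((I x₀ y × I x y) × (∀ y′ → I x₀ y′ → I x y′ → y′ ≡ y)))
  where

  Pencil : Set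
  Pencil = Σ Y (I x₀)

  position : ∀ {x} y → I x y → Fin (suc k)
  position y h = to (block y) (_ , h)

  other : Pencil → Fin k → X
  other (y , h₀) j = proj₁ (from (block y) (punchIn (position y h₀) j))

  other-on : ∀ ((y , h₀) : Pencil) j → I (other (y , h₀) j) y
  other-on (y , h₀) j = proj₂ (from (block y) (punchIn (position y h₀) j))

  position-other : ∀ ((y , h₀) : Pencil) j {h : I (other (y , h₀) j) y} →
                   position y h ≡ punchIn (position y h₀) j
  position-other (y , h₀) j = trans (cong (to (block y)) (Σ-≡-proj₁ I-irrelevant refl))
                                    (strictlyInverseˡ (block y) _)

  position-≢ : ∀ y {x x′} (h : I x y) (h′ : I x′ y) → x ≢ x′ → position y h ≢ position y h′
  position-≢ y h h′ x≢x′ = x≢x′ ∘ cong proj₁ ∘ to-injective (block y)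

  other-≢ : ∀ t j → other t j ≢ x₀
  other-≢ (y , h₀) j eq = punchInᵢ≢i (position y h₀) j (begin
    punchIn (position y h₀) j        ≡⟨ position-other (y , h₀) j ⟨
    position y (other-on (y , h₀) j) ≡⟨ cong (to (block y)) (Σ-≡-proj₁ I-irrelevant eq) ⟩
    position y h₀                    ∎)
    where open ≡-Reasoning

  locate : ∀ x → x ≢ x₀ → Pencil × Fin k
  locate x x≢x₀ with join x x≢x₀
  ... | y , (h₀ , h) , _ = (y , h₀) , punchOut (position-≢ y h₀ h (x≢x₀ ∘ sym))

  other-locate : ∀ x (x≢x₀ : x ≢ x₀) → uncurry other (locate x x≢x₀) ≡ x
  other-locate x x≢x₀ with join x x≢x₀
  ... | y , (h₀ , h) , _ = cong proj₁ (begin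
    from (block y) (punchIn (position y h₀) (punchOut x₀≢x))
      ≡⟨ cong (from (block y)) (punchIn-punchOut x₀≢x) ⟩
    from (block y) (position y h)
      ≡⟨ strictlyInverseʳ (block y) (x , h) ⟩
    (x , h)
      ∎)
    where
    open ≡-Reasoning
    x₀≢x = position-≢ y h₀ h (x≢x₀ ∘ sym)

  locate-other : ∀ t j (ne : other t j ≢ x₀) → locate (other t j) ne ≡ (t , j)
  locate-other (y , h₀) j ne with join (other (y , h₀) j) ne
  ... | y′ , (h₀′ , h′) , unique with unique y h₀ (other-on (y , h₀) j)
  ... | refl with I-irrelevant h₀′ h₀
  ... | refl = cong ((y , h₀) ,_)
    (trans (punchOut-cong (position y h₀) (position-other (y , h₀) j)) (punchOut-punchIn (position y h₀)))

  split : X → ⊤ ⊎ (Pencil × Fin k)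
  split x with x ≟ x₀
  ... | yes _     = inj₁ tt
  ... | no x≢x₀   = inj₂ (locate x x≢x₀)

  unsplit : ⊤ ⊎ (Pencil × Fin k) → X
  unsplit (inj₁ _)       = x₀
  unsplit (inj₂ (t , j)) = other t j

  split-unsplit : ∀ u → split (unsplit u) ≡ u
  split-unsplit (inj₁ tt) with x₀ ≟ x₀
  ... | yes _     = refl
  ... | no x₀≢x₀  = ⊥-elim (x₀≢x₀ refl)
  split-unsplit (inj₂ (t , j)) with other t j ≟ x₀
  ... | yes eq    = ⊥-elim (other-≢ t j eq)
  ... | no ne     = cong inj₂ (locate-other t j ne)

  unsplit-split : ∀ x → unsplit (split x) ≡ x
  unsplit-split x with x ≟ x₀
  ... | yes x≡x₀  = sym x≡x₀
  ... | no x≢x₀   = other-locate x x≢x₀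

  decomposition : X ↔ (⊤ ⊎ (Pencil × Fin k))
  decomposition = mk↔ₛ′ split unsplit split-unsplit unsplit-split

  count : ∀ {k′} → Pencil ↔ Fin (suc k′) → X ↔ Fin (suc (suc k′ * k))
  count pencil = ↔-trans decomposition
    (↔-trans (↔-sym 1↔⊤ ⊎-↔ ↔-trans (pencil ×-↔ ↔-refl) (↔-sym *↔×)) (↔-sym +↔⊎))

module LinearSpaceMatrix
  {X Y : Set} (I : X → Y → Set) (I-irrelevant : ∀ {x y} → Irrelevant (I x y))
  {p q k d : ℕ} .{{_ : NonZero d}}
  (points : X ↔ Fin p) (lines : Y ↔ Fin q)
  (pointsOn : ∀ y → Σ X (λ x → I x y) ↔ Fin k)
  (label : ∀ x → Σ Y (I x) → Fin d) (label-injective : ∀ x → Injective _≡_ _≡_ (label x))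
  (collinear : ∀ x x′ → ∃[ y ] (I x y × I x′ y))
  where
  open CyclicGroup d

  colours : Fin (p * d) ↔ (X × Fin d)
  colours = ↔-trans *↔× (↔-sym points ×-↔ ↔-refl)

  entry : ∀ y → Σ X (λ x → I x y) → Fin d → X × Fin d
  entry y (x , h) b = x , b +ₘ label x (y , h)

  entry-injective : ∀ y {u u′ b b′} → entry y u b ≡ entry y u′ b′ → u ≡ u′ × b ≡ b′
  entry-injective y {x , h} {x′ , h′} eq with cong proj₁ eq
  ... | refl with I-irrelevant h h′
  ... | refl = refl , +ₘ-cancelʳ _ (cong proj₂ eq)

  entry-line-injective : ∀ {y y′} u u′ b → entry y u b ≡ entry y′ u′ b → y ≡ y′
  entry-line-injective (x , h) (x′ , h′) b eq with cong proj₁ eq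
  ... | refl = cong proj₁ (label-injective x (+ₘ-cancelˡ b (cong proj₂ eq)))

  row : Y → Fin k × Fin d → X × Fin d
  row y (a , b) = entry y (from (pointsOn y) a) b

  row-injective : ∀ y → Injective _≡_ _≡_ (row y)
  row-injective y {a , b} {a′ , b′} eq with entry-injective y eq
  ... | u≡u′ , refl = cong (_, b) (from-injective (pointsOn y) u≡u′)

  row-line-injective : ∀ {y y′} ab → row y ab ≡ row y′ ab → y ≡ y′
  row-line-injective {y} {y′} (a , b) =
    entry-line-injective (from (pointsOn y) a) (from (pointsOn y′) a) b

  row-surjective : ∀ {x y} → I x y → ∀ c → ∃[ ab ] row y ab ≡ (x , c)
  row-surjective {x} {y} h c = (to (pointsOn y) (x , h) , c -ₘ t) , (begin
    entry y (from (pointsOn y) (to (pointsOn y) (x , h))) (c -ₘ t)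
      ≡⟨ cong (λ u → entry y u (c -ₘ t)) (strictlyInverseʳ (pointsOn y) (x , h)) ⟩
    (x , (c -ₘ t) +ₘ t)
      ≡⟨ cong (x ,_) (i-ₘj+ₘj≡i c t) ⟩
    (x , c)
      ∎)
    where
    open ≡-Reasoning
    t = label x (y , h)

  matrix : Matrix q (k * d) (Fin (p * d))
  matrix i j = from colours (row (from lines i) (to *↔× j))

  matrix-hits : ∀ {x y} → I x y → ∀ c → ∃[ j ] matrix (to lines y) j ≡ from colours (x , c)
  matrix-hits {x} {y} h c with row-surjective h c
  ... | ab , row≡ = from *↔× ab , (begin
    from colours (row (from lines (to lines y)) (to *↔× (from *↔× ab)))
      ≡⟨ cong₂ (λ y′ ab′ → from colours (row y′ ab′)) (strictlyInverseʳ lines y) (strictlyInverseˡ *↔× ab) ⟩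
    from colours (row y ab)
      ≡⟨ cong (from colours) row≡ ⟩
    from colours (x , c)
      ∎)
    where open ≡-Reasoning

  pairInSomeRow : ∀ c₁ c₂ → PairInSomeRow matrix c₁ c₂
  pairInSomeRow c₁ c₂ with to colours c₁ in eq₁ | to colours c₂ in eq₂
  ... | x₁ , k₁ | x₂ , k₂ with collinear x₁ x₂
  ... | y , h₁ , h₂ with matrix-hits h₁ k₁ | matrix-hits h₂ k₂
  ... | j₁ , e₁ | j₂ , e₂ = to lines y , j₁ , j₂ , trans e₁ (back eq₁) , trans e₂ (back eq₂)
    where
    back : ∀ {c u} → to colours c ≡ u → from colours u ≡ c
    back {c} refl = strictlyInverseʳ colours c

  matrix-M* : InM* matrix
  matrix-M* = (rows , cols , λ c₁ c₂ _ → inj₁ (pairInSomeRow c₁ c₂)) , λ c₁ c₂ _ → pairInSomeRow c₁ c₂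
    where
    rows : RowsDistinct matrix
    rows i = to-injective *↔× ∘ row-injective (from lines i) ∘ from-injective colours
    cols : ColsDistinct matrix
    cols j = from-injective lines ∘ row-line-injective (to *↔× j) ∘ from-injective colours

InM⇒AchrAtLeast : ∀ {p q c} {M : Matrix p q (Fin c)} → InM M → AchrAtLeast (K p □ K q) c
InM⇒AchrAtLeast {p} {q} {c} {M} (rows , cols , pairs) = c , ≤-refl , uncurry M , proper , complete
  where
  proper : IsProper (K p □ K q) (uncurry M)
  proper (i , j) (.i , j′) (inj₁ (refl , j≢j′)) = j≢j′ ∘ rows i
  proper (i , j) (i′ , .j) (inj₂ (i≢i′ , refl)) = i≢i′ ∘ cols j
  complete : IsComplete (K p □ K q) (uncurry M)
  complete c₁ c₂ c₁≢c₂ with pairs c₁ c₂ c₁≢c₂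
  ... | inj₁ (i , j , j′ , e₁ , e₂) =
    (i , j) , (i , j′) , inj₁ (refl , λ { refl → c₁≢c₂ (trans (sym e₁) e₂) }) , e₁ , e₂
  ... | inj₂ (j , i , i′ , e₁ , e₂) =
    (i , j) , (i′ , j) , inj₂ ((λ { refl → c₁≢c₂ (trans (sym e₁) e₂) }) , refl) , e₁ , e₂

module ProjectivePlane {r n m : ℕ} {L : Fin m → Subset n} (plane : IsProjectivePlane r L) where
  open IsProjectivePlane plane

  PointsOn : Fin m → Set
  PointsOn l = Σ (Fin n) (_∈ L l)

  LinesThrough : Fin n → Set
  LinesThrough x = Σ (Fin m) (λ l → x ∈ L l)

  join : ∀ x y → x ≢ y → Fin m
  join x y x≢y = proj₁ (two-points x y x≢y)

  ∈-joinˡ : ∀ {x y} (x≢y : x ≢ y) → x ∈ L (join x y x≢y)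
  ∈-joinˡ {x} {y} x≢y = proj₁ (proj₁ (proj₂ (two-points x y x≢y)))

  ∈-joinʳ : ∀ {x y} (x≢y : x ≢ y) → y ∈ L (join x y x≢y)
  ∈-joinʳ {x} {y} x≢y = proj₂ (proj₁ (proj₂ (two-points x y x≢y)))

  line-unique : ∀ {x y l l′} → x ≢ y → x ∈ L l → y ∈ L l → x ∈ L l′ → y ∈ L l′ → l ≡ l′
  line-unique {x} {y} {l} {l′} x≢y x∈l y∈l x∈l′ y∈l′ =
    trans (unique l x∈l y∈l) (sym (unique l′ x∈l′ y∈l′))
    where unique = proj₂ (proj₂ (two-points x y x≢y))

  meet : ∀ l l′ → l ≢ l′ → Fin n
  meet l l′ l≢l′ = proj₁ (two-lines l l′ l≢l′)

  ∈-meetˡ : ∀ {l l′} (l≢l′ : l ≢ l′) → meet l l′ l≢l′ ∈ L l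
  ∈-meetˡ {l} {l′} l≢l′ = proj₁ (proj₂ (two-lines l l′ l≢l′))

  ∈-meetʳ : ∀ {l l′} (l≢l′ : l ≢ l′) → meet l l′ l≢l′ ∈ L l′
  ∈-meetʳ {l} {l′} l≢l′ = proj₂ (proj₂ (two-lines l l′ l≢l′))

  point-unique : ∀ {x y l l′} → l ≢ l′ → x ∈ L l → x ∈ L l′ → y ∈ L l → y ∈ L l′ → x ≡ y
  point-unique {x} {y} l≢l′ x∈l x∈l′ y∈l y∈l′ with x ≟ y
  ... | yes x≡y = x≡y
  ... | no x≢y  = ⊥-elim (l≢l′ (line-unique x≢y x∈l y∈l x∈l′ y∈l′))

  ∈⇒≢ : ∀ {l l′ x} → x ∈ L l → x ∉ L l′ → l ≢ l′
  ∈⇒≢ x∈l x∉l′ refl = x∉l′ x∈l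

  ∉⇒≢ : ∀ {l x y} → x ∉ L l → y ∈ L l → x ≢ y
  ∉⇒≢ x∉l y∈l refl = x∉l y∈l

  q : Fin 4 → Fin n
  q = proj₁ four-points

  q-injective : ∀ {i j} → i ≢ j → q i ≢ q j
  q-injective i≢j = i≢j ∘ proj₁ (proj₂ four-points)

  not-collinear : ∀ {i j k} → i ≢ j → j ≢ k → i ≢ k →
                  ∀ {l} → q i ∈ L l → q j ∈ L l → q k ∈ L l → ⊥
  not-collinear i≢j j≢k i≢k {l} qi∈l qj∈l qk∈l =
    proj₂ (proj₂ four-points) _ _ _ i≢j j≢k i≢k (l , qi∈l , qj∈l , qk∈l)

  diagonal-point-off : ∀ {a b c d} → a ≢ b → a ≢ c → a ≢ d → b ≢ c → b ≢ d → c ≢ d →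
    ∀ {l l′} → q a ∈ L l → q b ∈ L l → q c ∈ L l′ → q d ∈ L l′ → ∃[ z ] (z ∉ L l × z ∉ L l′)
  diagonal-point-off {a} {b} {c} {d} a≢b a≢c a≢d b≢c b≢d c≢d {l} {l′} a∈l b∈l c∈l′ d∈l′ =
    z , z∉l , z∉l′
    where
    qa≢qc = q-injective a≢c
    qb≢qd = q-injective b≢d
    u = join (q a) (q c) qa≢qc
    v = join (q b) (q d) qb≢qd
    u≢v : u ≢ v
    u≢v u≡v = not-collinear a≢b b≢c a≢c
      (∈-joinˡ qa≢qc) (subst (λ w → q b ∈ L w) (sym u≡v) (∈-joinˡ qb≢qd)) (∈-joinʳ qa≢qc)
    z = meet u v u≢v
    z∉l : z ∉ L l
    z∉l z∈l with z ≟ q a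
    ... | yes z≡qa = not-collinear a≢b b≢d a≢d
                       (subst (λ w → w ∈ L v) z≡qa (∈-meetʳ u≢v)) (∈-joinˡ qb≢qd) (∈-joinʳ qb≢qd)
    ... | no z≢qa  = not-collinear a≢b b≢c a≢c a∈l b∈l
                       (subst (λ w → q c ∈ L w) (line-unique z≢qa (∈-meetˡ u≢v) (∈-joinˡ qa≢qc) z∈l a∈l)
                              (∈-joinʳ qa≢qc))
    z∉l′ : z ∉ L l′
    z∉l′ z∈l′ with z ≟ q c
    ... | yes z≡qc = not-collinear b≢c c≢d b≢d
                       (∈-joinˡ qb≢qd) (subst (λ w → w ∈ L v) z≡qc (∈-meetʳ u≢v)) (∈-joinʳ qb≢qd)
    ... | no z≢qc  = not-collinear a≢c c≢d a≢d
                       (subst (λ w → q a ∈ L w) (line-unique z≢qc (∈-meetˡ u≢v) (∈-joinʳ qa≢qc) z∈l′ c∈l′)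
                              (∈-joinˡ qa≢qc))
                       c∈l′ d∈l′

  private
    Placement : Fin m → Fin m → Fin n → Set
    Placement l l′ x = (x ∉ L l × x ∉ L l′) ⊎ (x ∈ L l ⊎ x ∈ L l′)

    place : ∀ l l′ x → Placement l l′ x
    place l l′ x with x ∈? L l | x ∈? L l′
    ... | yes x∈l | _        = inj₂ (inj₁ x∈l)
    ... | no _    | yes x∈l′ = inj₂ (inj₂ x∈l′)
    ... | no x∉l  | no x∉l′  = inj₁ (x∉l , x∉l′)

  -- A line contains at most two of the four points q.  So either one of them is off both lines,
  -- or each line contains exactly two of them and the diagonal point of the four is off both.
  point-off-two-lines : ∀ l l′ → ∃[ z ] (z ∉ L l × z ∉ L l′)
  point-off-two-lines l l′
    with place l l′ (q 0F) | place l l′ (q 1F) | place l l′ (q 2F) | place l l′ (q 3F)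
  ... | inj₁ off | _ | _ | _ = _ , off
  ... | _ | inj₁ off | _ | _ = _ , off
  ... | _ | _ | inj₁ off | _ = _ , off
  ... | _ | _ | _ | inj₁ off = _ , off
  ... | inj₂ (inj₁ a) | inj₂ (inj₁ b) | inj₂ (inj₁ c) | _ = ⊥-elim (not-collinear (λ ()) (λ ()) (λ ()) a b c)
  ... | inj₂ (inj₁ a) | inj₂ (inj₁ b) | _ | inj₂ (inj₁ d) = ⊥-elim (not-collinear (λ ()) (λ ()) (λ ()) a b d)
  ... | inj₂ (inj₁ a) | _ | inj₂ (inj₁ c) | inj₂ (inj₁ d) = ⊥-elim (not-collinear (λ ()) (λ ()) (λ ()) a c d)
  ... | _ | inj₂ (inj₁ b) | inj₂ (inj₁ c) | inj₂ (inj₁ d) = ⊥-elim (not-collinear (λ ()) (λ ()) (λ ()) b c d)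
  ... | inj₂ (inj₂ a) | inj₂ (inj₂ b) | inj₂ (inj₂ c) | _ = ⊥-elim (not-collinear (λ ()) (λ ()) (λ ()) a b c)
  ... | inj₂ (inj₂ a) | inj₂ (inj₂ b) | _ | inj₂ (inj₂ d) = ⊥-elim (not-collinear (λ ()) (λ ()) (λ ()) a b d)
  ... | inj₂ (inj₂ a) | _ | inj₂ (inj₂ c) | inj₂ (inj₂ d) = ⊥-elim (not-collinear (λ ()) (λ ()) (λ ()) a c d)
  ... | _ | inj₂ (inj₂ b) | inj₂ (inj₂ c) | inj₂ (inj₂ d) = ⊥-elim (not-collinear (λ ()) (λ ()) (λ ()) b c d)
  ... | inj₂ (inj₁ a) | inj₂ (inj₁ b) | inj₂ (inj₂ c) | inj₂ (inj₂ d) =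
    diagonal-point-off (λ ()) (λ ()) (λ ()) (λ ()) (λ ()) (λ ()) a b c d
  ... | inj₂ (inj₁ a) | inj₂ (inj₂ b) | inj₂ (inj₁ c) | inj₂ (inj₂ d) =
    diagonal-point-off (λ ()) (λ ()) (λ ()) (λ ()) (λ ()) (λ ()) a c b d
  ... | inj₂ (inj₁ a) | inj₂ (inj₂ b) | inj₂ (inj₂ c) | inj₂ (inj₁ d) =
    diagonal-point-off (λ ()) (λ ()) (λ ()) (λ ()) (λ ()) (λ ()) a d b c
  ... | inj₂ (inj₂ a) | inj₂ (inj₁ b) | inj₂ (inj₁ c) | inj₂ (inj₂ d) =
    diagonal-point-off (λ ()) (λ ()) (λ ()) (λ ()) (λ ()) (λ ()) b c a d
  ... | inj₂ (inj₂ a) | inj₂ (inj₁ b) | inj₂ (inj₂ c) | inj₂ (inj₁ d) =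
    diagonal-point-off (λ ()) (λ ()) (λ ()) (λ ()) (λ ()) (λ ()) b d a c
  ... | inj₂ (inj₂ a) | inj₂ (inj₂ b) | inj₂ (inj₁ c) | inj₂ (inj₁ d) =
    diagonal-point-off (λ ()) (λ ()) (λ ()) (λ ()) (λ ()) (λ ()) c d a b

  private
    line₀₁ line₂₃ line₀₂ : Fin m
    line₀₁ = join (q 0F) (q 1F) (q-injective (λ ()))
    line₂₃ = join (q 2F) (q 3F) (q-injective (λ ()))
    line₀₂ = join (q 0F) (q 2F) (q-injective (λ ()))

  -- If x were on all three lines, then x = q₀ (the only common point of line₀₁ and line₀₂),
  -- but q₀ is not on line₂₃.
  line-off : ∀ x → ∃[ l ] (x ∉ L l)
  line-off x with x ∈? L line₀₁ | x ∈? L line₂₃ | x ∈? L line₀₂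
  ... | no x∉l | _ | _ = _ , x∉l
  ... | _ | no x∉l | _ = _ , x∉l
  ... | _ | _ | no x∉l = _ , x∉l
  ... | yes x∈01 | yes x∈23 | yes x∈02 with x ≟ q 0F
  ...   | yes x≡q₀ = ⊥-elim $ not-collinear {0F} {2F} {3F} (λ ()) (λ ()) (λ ())
                       (subst (λ y → y ∈ L line₂₃) x≡q₀ x∈23) (∈-joinˡ _) (∈-joinʳ _)
  ...   | no x≢q₀  = ⊥-elim $ not-collinear {0F} {1F} {2F} (λ ()) (λ ()) (λ ()) (∈-joinˡ _) (∈-joinʳ _)
                       (subst (λ l → q 2F ∈ L l) (line-unique x≢q₀ x∈02 (∈-joinˡ _) x∈01 (∈-joinˡ _))
                              (∈-joinʳ _))

  project : ∀ {z l l′} → z ∉ L l → z ∉ L l′ → PointsOn l → PointsOn l′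
  project {z} z∉l z∉l′ (x , x∈l) = meet (join z x z≢x) _ (∈⇒≢ (∈-joinˡ z≢x) z∉l′) , ∈-meetʳ _
    where z≢x = ∉⇒≢ z∉l x∈l

  project-project : ∀ {z l l′} (z∉l : z ∉ L l) (z∉l′ : z ∉ L l′) u →
                    project z∉l′ z∉l (project z∉l z∉l′ u) ≡ u
  project-project {z} z∉l z∉l′ (x , x∈l) = Σ-≡-proj₁ ∈-irrelevant
    (point-unique (∈⇒≢ (∈-joinˡ z≢y) z∉l) (∈-meetˡ _) (∈-meetʳ _) x∈zy x∈l)
    where
    z≢x = ∉⇒≢ z∉l x∈l
    y = proj₁ (project z∉l z∉l′ (x , x∈l))
    z≢y = ∉⇒≢ z∉l′ (proj₂ (project z∉l z∉l′ (x , x∈l)))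
    zy≡zx : join z y z≢y ≡ join z x z≢x
    zy≡zx = line-unique z≢y (∈-joinˡ _) (∈-joinʳ _) (∈-joinˡ _) (∈-meetˡ _)
    x∈zy : x ∈ L (join z y z≢y)
    x∈zy = subst (λ l → x ∈ L l) (sym zy≡zx) (∈-joinʳ _)

  perspectivity : ∀ {z l l′} → z ∉ L l → z ∉ L l′ → PointsOn l ↔ PointsOn l′
  perspectivity z∉l z∉l′ =
    mk↔ₛ′ (project z∉l z∉l′) (project z∉l′ z∉l) (project-project z∉l′ z∉l) (project-project z∉l z∉l′)

  linesThrough↔pointsOn : ∀ {x l} → x ∉ L l → LinesThrough x ↔ PointsOn l
  linesThrough↔pointsOn {x} {l} x∉l = mk↔ₛ′
    (λ (l′ , x∈l′) → meet l′ l (∈⇒≢ x∈l′ x∉l) , ∈-meetʳ _)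
    (λ (y , y∈l) → join x y (∉⇒≢ x∉l y∈l) , ∈-joinˡ _)
    (λ (y , y∈l) → Σ-≡-proj₁ ∈-irrelevant
      (point-unique (∈⇒≢ (∈-joinˡ _) x∉l) (∈-meetˡ _) (∈-meetʳ _) (∈-joinʳ _) y∈l))
    (λ (l′ , x∈l′) → Σ-≡-proj₁ ∈-irrelevant
      (line-unique (∉⇒≢ x∉l (∈-meetʳ _)) (∈-joinˡ _) (∈-joinʳ _) x∈l′ (∈-meetˡ _)))

  pointsOn↔ : ∀ l → PointsOn l ↔ Fin (suc r)
  pointsOn↔ l with line-size | point-off-two-lines l (proj₁ line-size)
  ... | l₀ , ∣l₀∣≡1+r | z , z∉l , z∉l₀ =
    ↔-trans (perspectivity z∉l z∉l₀) (subst (λ k → PointsOn l₀ ↔ Fin k) ∣l₀∣≡1+r (∈↔Fin∣∣ (L l₀)))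

  linesThrough↔ : ∀ x → LinesThrough x ↔ Fin (suc r)
  linesThrough↔ x = ↔-trans (linesThrough↔pointsOn (proj₂ (line-off x))) (pointsOn↔ _)

  private
    1+[1+r]*r≡r*r+r+1 : suc (suc r * r) ≡ r * r + r + 1
    1+[1+r]*r≡r*r+r+1 = trans (cong suc (+-comm r (r * r))) (+-comm 1 (r * r + r))

  points↔ : Fin n ↔ Fin (r * r + r + 1)
  points↔ = subst (λ k → Fin n ↔ Fin k) 1+[1+r]*r≡r*r+r+1 (count (linesThrough↔ (q 0F)))
    where
    open PencilDecomposition (λ x l → x ∈ L l) ∈-irrelevant _≟_ pointsOn↔ (q 0F)
           (λ x x≢q₀ → two-points (q 0F) x (x≢q₀ ∘ sym))

  lines↔ : Fin m ↔ Fin (r * r + r + 1)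
  lines↔ = subst (λ k → Fin m ↔ Fin k) 1+[1+r]*r≡r*r+r+1 (count (pointsOn↔ l₀))
    where
    l₀ = proj₁ line-size
    open PencilDecomposition (λ l x → x ∈ L l) ∈-irrelevant _≟_ linesThrough↔ l₀
           (λ l l≢l₀ → meet l₀ l (l≢l₀ ∘ sym) , (∈-meetˡ _ , ∈-meetʳ _) ,
                        λ z z∈l₀ z∈l → point-unique (l≢l₀ ∘ sym) z∈l₀ z∈l (∈-meetˡ _) (∈-meetʳ _))

  line-through : ∀ x y → ∃[ l ] (x ∈ L l × y ∈ L l)
  line-through x y with x ≟ y
  ... | yes refl = let (l , x∈l) = from (linesThrough↔ x) zero in l , x∈l , x∈l
  ... | no x≢y   = join x y x≢y , ∈-joinˡ x≢y , ∈-joinʳ x≢y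

planeMatrix : ∀ {r n m} {L : Fin m → Subset n} → IsProjectivePlane r L →
              ∀ d .{{_ : NonZero d}} → suc r ≤ d →
              M*-nonempty (r * r + r + 1) (suc r * d) (Fin ((r * r + r + 1) * d))
planeMatrix {L = L} plane d 1+r≤d = matrix , matrix-M*
  where
  open ProjectivePlane plane
  label : ∀ x → LinesThrough x → Fin d
  label x t = inject≤ (to (linesThrough↔ x) t) 1+r≤d
  label-injective : ∀ x → Injective _≡_ _≡_ (label x)
  label-injective x = to-injective (linesThrough↔ x) ∘ inject≤-injective 1+r≤d 1+r≤d _ _
  open LinearSpaceMatrix (λ x l → x ∈ L l) ∈-irrelevant
         points↔ lines↔ pointsOn↔ label label-injective line-through

lemma2p3 : (r s : ℕ) → 2 ≤ r → IsProjectivePlaneOrder r → suc r ≤ s →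
    M*-nonempty (r * r + r + 1) (suc r * s) (Fin ((r * r + r + 1) * s)) ×
    AchrAtLeast (K (r * r + r + 1) □ K (suc r * s)) ((r * r + r + 1) * s)
lemma2p3 r zero _ _ ()
lemma2p3 r s@(suc _) _ (_ , _ , _ , plane) 1+r≤s = M* , InM⇒AchrAtLeast (proj₁ (proj₂ M*))
  where
  M* = planeMatrix plane s 1+r≤s
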